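{- Define numbers $k_i$ and functions $b_i:[0,\infty)\to\mathbb{R}$ ($i\ge2$) iteratively as follows: $k_1=1$, $k_2=2$, $b_2(x)=\rho(x/k_1)-\frac{k_2}{k_1}\rho(x/k_2)$; and for $i\ge2$, $k_{i+1}=k_i+j$ where $j$ is the least positive integer with $b_i(k_i+j)\neq b_i(k_i)$, and $$ b_{i+1}(x)=b_i(x)+\bigl(1+b_i(k_i)\bigr)\left[\rho\!\left(\frac{x}{k_i}\right)-\frac{k_{i+1}}{k_i}\,\rho\!\left(\frac{x}{k_{i+1}}\right)\right]. $$ Consider the following conditions: (a) $\displaystyle\sum_{j=1}^{i}\frac{\mu(k_j)}{k_j}=\frac{1+b_i(k_i)}{k_i}$ for all $i\ge2$; (b) $\displaystyle b_i(x)=\sum_{j=1}^{i-1}\mu(k_j)\,\rho\!\left(\frac{x}{k_j}\right)-k_i\left(\sum_{j=1}^{i-1}\frac{\mu(k_j)}{k_j}\right)\rho\!\left(\frac{x}{k_i}\right)$ for all $x\ge0$ and all $i\ge2$; (c) $\displaystyle\frac{\mu(k_i)}{k_i}=\frac{1+b_i(k_i)}{k_i}-\frac{1+b_{i-1}(k_{i-1})}{k_{i-1}}$ for all $i\ge3$; (d) $\mu(k_{i+1})=b_i(k_{i+1})-b_i(k_i)$ for all $i\ge2$; (e) $\displaystyle\sum_{j=1}^{i}\mu(k_j)\left\lfloor\frac{k_i}{k_j}\right\rfloor=1$ for all $i\ge1$. Then (a), (b), (c) are equivalent. Furthermore, if $k_{i+1}<2k_i$ for all $i\ge2$, then (a),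 (b), (c), (d), (e) are all equivalent.
   Context: $\rho(x)=x-\lfloor x\rfloor$ denotes the fractional part of $x$, where $\lfloor x\rfloor$ is the greatest integer $\le x$. $\mu$ denotes the Möbius function: $\mu(1)=1$, $\mu(m)=(-1)^r$ if $m$ is a product of $r$ distinct primes, and $\mu(m)=0$ if $m$ is divisible by the square of a prime.
   Formalization: The functions $b_i$ are taken on the rationals instead of $[0,\infty)$, so condition (b) is asserted only for rational x ≥ 0. -}

module Defs where

open import Data.Nat as ℕ using (ℕ; zero; suc; _≤_; _<_)
import Data.Nat.DivMod as ℕD
open import Data.Nat.Divisibility using (_∣?_)
open import Data.Nat.Primality using (prime?)
open import Data.Integer as ℤ using (ℤ; +_)
open import Data.Rational as ℚ using (ℚ; floor; 0ℚ; 1ℚ)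
open import Data.List using (List; []; _∷_; filter; upTo; length)
open import Data.Bool using (Bool; true; _∧_)
open import Data.Bool using (if_then_else_)
open import Relation.Nullary.Decidable using (_×-dec_; ¬?; does)
open import Relation.Binary.PropositionalEquality using (_≡_; _≢_)
open import Function.Bundles using (_⇔_)
open import Data.Product using (_×_)

ρ : ℚ → ℚ
ρ x = x ℚ.- (floor x ℚ./ 1)

ι : ℕ → ℚ
ι n = + n ℚ./ 1

-- x / m for a natural m (junk value 0 when m = 0; only used with m > 0)
_÷ℕ_ : ℚ → ℕ → ℚ
x ÷ℕ zero = 0ℚ
x ÷ℕ suc m = x ℚ.* (+ 1 ℚ./ suc m)

-- ⌊ n / m ⌋ for naturals (junk 0 when m = 0)
_divℕ_ : ℕ → ℕ → ℕ
n divℕ zero = 0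
n divℕ suc m = n ℕD./ suc m

-- Möbius function: primes p ≤ n dividing n; μ(n) = 0 if some p² ∣ n,
-- otherwise (-1)^(number of prime divisors). (μ(0) is junk, never used.)
primeDivisors : ℕ → List ℕ
primeDivisors n = filter (λ p → prime? p ×-dec (p ∣? n)) (upTo (suc n))

allB : (ℕ → Bool) → List ℕ → Bool
allB P [] = true
allB P (x ∷ xs) = P x ∧ allB P xs

μ : ℕ → ℤ
μ n = if allB (λ p → does (¬? ((p ℕ.* p) ∣? n))) (primeDivisors n)
      then (ℤ.- (+ 1)) ℤ.^ length (primeDivisors n)
      else + 0

-- The functions b_i (i ≥ 2) built from a sequence k (k 1, k 2, ... used);
-- b 0 and b 1 are junk.
b : (ℕ → ℕ) → ℕ → ℚ → ℚ
b k zero x = 0ℚ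
b k (suc zero) x = 0ℚ
b k (suc (suc zero)) x =
  ρ (x ÷ℕ k 1) ℚ.- ((ι (k 2) ÷ℕ k 1) ℚ.* ρ (x ÷ℕ k 2))
b k (suc (suc (suc n))) x =
  b k (suc (suc n)) x ℚ.+ ((1ℚ ℚ.+ b k (suc (suc n)) (ι (k (suc (suc n))))) ℚ.*
    (ρ (x ÷ℕ k (suc (suc n))) ℚ.-
      ((ι (k (suc (suc (suc n)))) ÷ℕ k (suc (suc n))) ℚ.* ρ (x ÷ℕ k (suc (suc (suc n)))))))

IsKSeq : (ℕ → ℕ) → Set
IsKSeq k =
  (k 1 ≡ 1) × (k 2 ≡ 2) ×
  (∀ i → 2 ≤ i →
     (k i < k (suc i)) ×
     (b k i (ι (k (suc i))) ≢ b k i (ι (k i))) ×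
     (∀ m → k i < m → m < k (suc i) → b k i (ι m) ≡ b k i (ι (k i))))

Σℚ : ℕ → (ℕ → ℚ) → ℚ
Σℚ zero f = 0ℚ
Σℚ (suc i) f = Σℚ i f ℚ.+ f (suc i)

Σℤ : ℕ → (ℕ → ℤ) → ℤ
Σℤ zero f = + 0
Σℤ (suc i) f = Σℤ i f ℤ.+ f (suc i)

μq : ℕ → ℚ
μq n = μ n ℚ./ 1

S : (ℕ → ℕ) → ℕ → ℚ
S k i = Σℚ i (λ j → μq (k j) ÷ℕ k j)

CondA CondB CondC CondD CondE : (ℕ → ℕ) → Set
CondA k = ∀ i → 2 ≤ i → S k i ≡ (1ℚ ℚ.+ b k i (ι (k i))) ÷ℕ k i
CondB k = ∀ i → 2 ≤ i → ∀ (x : ℚ) → 0ℚ ℚ.≤ x →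
  b k i x ≡ Σℚ (i ℕ.∸ 1) (λ j → μq (k j) ℚ.* ρ (x ÷ℕ k j))
            ℚ.- ((ι (k i) ℚ.* S k (i ℕ.∸ 1)) ℚ.* ρ (x ÷ℕ k i))
CondC k = ∀ i → 3 ≤ i →
  μq (k i) ÷ℕ k i ≡ ((1ℚ ℚ.+ b k i (ι (k i))) ÷ℕ k i)
                     ℚ.- ((1ℚ ℚ.+ b k (i ℕ.∸ 1) (ι (k (i ℕ.∸ 1)))) ÷ℕ k (i ℕ.∸ 1))
CondD k = ∀ i → 2 ≤ i →
  μq (k (suc i)) ≡ b k i (ι (k (suc i))) ℚ.- b k i (ι (k i))
CondE k = ∀ i → 1 ≤ i →
  Σℤ i (λ j → μ (k j) ℤ.* + (k i divℕ k j)) ≡ + 1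

-- Write c_i = 1 + b_i(k_i) and S_i = Σ_{j≤i} μ(k_j)/k_j, so that (a) reads
-- c_i = k_i S_i.  Unfolding the recursion for b_{i+1} shows that this is exactly
-- what turns (b) at i into (b) at i+1; conversely, evaluating (b) at i and at
-- i+1 in x = k_i, where ρ(k_i/k_i) = 0 and ρ(k_i/k_{i+1}) = k_i/k_{i+1}, forces
-- c_i = k_i S_i.  (c) is (a) telescoped.  At x = k_i, (b) gives
-- b_i(k_i) = k_i S_{i-1} - Σ_{j<i} μ(k_j)⌊k_i/k_j⌋, which turns (a) at i into
-- (e) at i; as (b) at i only needs (a) below i, (e) ⇒ (a) is an induction.
-- When k_{i+1} < 2k_i we have ⌊k_{i+1}/k_i⌋ = 1, and the increment
-- c_{i+1}/k_{i+1} - c_i/k_i of (c) becomes (b_i(k_{i+1}) - b_i(k_i))/k_{i+1},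
-- which is (d).
module Submission where

open import Defs
open import Data.Nat using (ℕ; zero; suc; _≤_; _<_)
open import Data.Product using (_×_; _,_; proj₁)
open import Function.Bundles using (_⇔_; mk⇔)
open import Function.Properties.Equivalence using () renaming (trans to ⇔-trans)
open import Relation.Binary.PropositionalEquality

module Arithmetic where
  open import Algebra.Properties.Group using (x∙y⁻¹≈ε⇒x≈y; x≈y⇒x∙y⁻¹≈ε)
  open import Data.Nat as ℕ using (_∸_; NonZero)
  import Data.Nat.Properties as ℕP
  import Data.Nat.DivMod as ℕD
  open import Data.Integer as ℤ using (+_; -[1+_])
  import Data.Integer.Properties as ℤP
  open import Data.Integer.Tactic.RingSolver using (solve-∀)
  open import Data.Rational as ℚ using (ℚ; mkℚ; floor; 0ℚ; 1ℚ; _+_; _-_; _*_; _/_; toℚᵘ)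
  open import Data.Rational.Properties
    using ( toℚᵘ-injective; toℚᵘ-cong; toℚᵘ-fromℚᵘ; toℚᵘ-homo-+; toℚᵘ-homo-*
          ; *-identityˡ; *-identityʳ; *-assoc; *-comm; *-zeroʳ; +-identityʳ; +-0-group
          ; nonNegative⁻¹; normalize-nonNeg)
  open import Data.Rational.Unnormalised as ℚᵘ using (mkℚᵘ; *≡*) renaming (_≃_ to _≃ᵘ_)
  import Data.Rational.Unnormalised.Properties as ℚᵘP
  open import Data.Rational.Solver using (module +-*-Solver)

  open +-*-Solver

  toℚᵘ-/1 : ∀ z → toℚᵘ (z / 1) ≃ᵘ mkℚᵘ z 0
  toℚᵘ-/1 z = toℚᵘ-fromℚᵘ (mkℚᵘ z 0)

  /1-homo-+ : ∀ a b → (a ℤ.+ b) / 1 ≡ a / 1 + b / 1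
  /1-homo-+ a b = toℚᵘ-injective (begin
    toℚᵘ ((a ℤ.+ b) / 1)           ≈⟨ toℚᵘ-/1 (a ℤ.+ b) ⟩
    mkℚᵘ (a ℤ.+ b) 0               ≈⟨ *≡* (cross a b) ⟩
    mkℚᵘ a 0 ℚᵘ.+ mkℚᵘ b 0         ≈⟨ ℚᵘP.+-cong (toℚᵘ-/1 a) (toℚᵘ-/1 b) ⟨
    toℚᵘ (a / 1) ℚᵘ.+ toℚᵘ (b / 1) ≈⟨ toℚᵘ-homo-+ (a / 1) (b / 1) ⟨
    toℚᵘ (a / 1 + b / 1)           ∎)
    where
    open ℚᵘP.≃-Reasoning
    cross : ∀ a b → (a ℤ.+ b) ℤ.* + 1 ≡ (a ℤ.* + 1 ℤ.+ b ℤ.* + 1) ℤ.* + 1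
    cross = solve-∀

  /1-homo-* : ∀ a b → (a ℤ.* b) / 1 ≡ (a / 1) * (b / 1)
  /1-homo-* a b = toℚᵘ-injective (begin
    toℚᵘ ((a ℤ.* b) / 1)           ≈⟨ toℚᵘ-/1 (a ℤ.* b) ⟩
    mkℚᵘ a 0 ℚᵘ.* mkℚᵘ b 0         ≈⟨ ℚᵘP.*-cong (toℚᵘ-/1 a) (toℚᵘ-/1 b) ⟨
    toℚᵘ (a / 1) ℚᵘ.* toℚᵘ (b / 1) ≈⟨ toℚᵘ-homo-* (a / 1) (b / 1) ⟨
    toℚᵘ ((a / 1) * (b / 1))       ∎)
    where open ℚᵘP.≃-Reasoning

  /1-injective : ∀ {a b} → a / 1 ≡ b / 1 → a ≡ b
  /1-injective {a} {b} eq = begin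
    a           ≡⟨ ℤP.*-identityʳ a ⟨
    a ℤ.* + 1   ≡⟨ ℚᵘP.drop-*≡* a≃b ⟩
    b ℤ.* + 1   ≡⟨ ℤP.*-identityʳ b ⟩
    b           ∎
    where
    open ≡-Reasoning
    a≃b : mkℚᵘ a 0 ≃ᵘ mkℚᵘ b 0
    a≃b = ℚᵘP.≃-trans (ℚᵘP.≃-sym (toℚᵘ-/1 a)) (ℚᵘP.≃-trans (toℚᵘ-cong eq) (toℚᵘ-/1 b))

  0≤ι : ∀ n → 0ℚ ℚ.≤ ι n
  0≤ι n = nonNegative⁻¹ (ι n) {{normalize-nonNeg n 1}}

  x÷ℕn≡x*[1÷ℕn] : ∀ x n → x ÷ℕ n ≡ x * (1ℚ ÷ℕ n)
  x÷ℕn≡x*[1÷ℕn] x zero    = sym (*-zeroʳ x)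
  x÷ℕn≡x*[1÷ℕn] x (suc n) = cong (x *_) (sym (*-identityˡ _))

  *-÷ℕ-assoc : ∀ x y n → x * (y ÷ℕ n) ≡ (x * y) ÷ℕ n
  *-÷ℕ-assoc x y n = begin
    x * (y ÷ℕ n)           ≡⟨ cong (x *_) (x÷ℕn≡x*[1÷ℕn] y n) ⟩
    x * (y * (1ℚ ÷ℕ n))    ≡⟨ *-assoc x y (1ℚ ÷ℕ n) ⟨
    (x * y) * (1ℚ ÷ℕ n)    ≡⟨ x÷ℕn≡x*[1÷ℕn] (x * y) n ⟨
    (x * y) ÷ℕ n           ∎
    where open ≡-Reasoning

  *-÷ℕ-comm : ∀ x y n → x * (y ÷ℕ n) ≡ y * (x ÷ℕ n)
  *-÷ℕ-comm x y n = begin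
    x * (y ÷ℕ n)           ≡⟨ *-÷ℕ-assoc x y n ⟩
    (x * y) ÷ℕ n           ≡⟨ cong (_÷ℕ n) (*-comm x y) ⟩
    (y * x) ÷ℕ n           ≡⟨ *-÷ℕ-assoc y x n ⟨
    y * (x ÷ℕ n)           ∎
    where open ≡-Reasoning

  toℚᵘ-ι-÷ℕ : ∀ m n .{{_ : NonZero n}} → toℚᵘ (ι m ÷ℕ n) ≃ᵘ + m ℚᵘ./ n
  toℚᵘ-ι-÷ℕ m n@(suc d) = begin
    toℚᵘ (ι m * (+ 1 / n))           ≈⟨ toℚᵘ-homo-* (ι m) (+ 1 / n) ⟩
    toℚᵘ (ι m) ℚᵘ.* toℚᵘ (+ 1 / n)
      ≈⟨ ℚᵘP.*-cong (toℚᵘ-/1 (+ m)) (toℚᵘ-fromℚᵘ (mkℚᵘ (+ 1) d)) ⟩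
    mkℚᵘ (+ m) 0 ℚᵘ.* mkℚᵘ (+ 1) d   ≈⟨ *≡* (cross (+ m) (+ n)) ⟩
    mkℚᵘ (+ m) d                     ∎
    where
    open ℚᵘP.≃-Reasoning
    cross : ∀ m n → (m ℤ.* + 1) ℤ.* n ≡ m ℤ.* (+ 1 ℤ.* n)
    cross = solve-∀

  ιn÷ℕn≡1 : ∀ n .{{_ : NonZero n}} → ι n ÷ℕ n ≡ 1ℚ
  ιn÷ℕn≡1 n@(suc _) =
    toℚᵘ-injective (ℚᵘP.≃-trans (toℚᵘ-ι-÷ℕ n n) (*≡* (ℤP.*-comm (+ n) (+ 1))))

  ιn*[x÷ℕn]≡x : ∀ n .{{_ : NonZero n}} x → ι n * (x ÷ℕ n) ≡ x
  ιn*[x÷ℕn]≡x n x = begin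
    ι n * (x ÷ℕ n)         ≡⟨ *-÷ℕ-comm (ι n) x n ⟩
    x * (ι n ÷ℕ n)         ≡⟨ cong (x *_) (ιn÷ℕn≡1 n) ⟩
    x * 1ℚ                 ≡⟨ *-identityʳ x ⟩
    x                      ∎
    where open ≡-Reasoning

  [ιn*x]÷ℕn≡x : ∀ n .{{_ : NonZero n}} x → (ι n * x) ÷ℕ n ≡ x
  [ιn*x]÷ℕn≡x n x = trans (sym (*-÷ℕ-assoc (ι n) x n)) (ιn*[x÷ℕn]≡x n x)

  [ιm÷ℕn]*[ιn÷ℕm]≡1 : ∀ m n .{{_ : NonZero m}} .{{_ : NonZero n}} →
                      (ι m ÷ℕ n) * (ι n ÷ℕ m) ≡ 1ℚ
  [ιm÷ℕn]*[ιn÷ℕm]≡1 m n = begin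
    (ι m ÷ℕ n) * (ι n ÷ℕ m)   ≡⟨ *-÷ℕ-assoc (ι m ÷ℕ n) (ι n) m ⟩
    ((ι m ÷ℕ n) * ι n) ÷ℕ m   ≡⟨ cong (_÷ℕ m) (trans (*-comm _ (ι n)) (ιn*[x÷ℕn]≡x n (ι m))) ⟩
    ι m ÷ℕ m                  ≡⟨ ιn÷ℕn≡1 m ⟩
    1ℚ                        ∎
    where open ≡-Reasoning

  ÷ℕ-injective : ∀ n .{{_ : NonZero n}} {x y} → x ÷ℕ n ≡ y ÷ℕ n → x ≡ y
  ÷ℕ-injective n {x} {y} eq = begin
    x                      ≡⟨ ιn*[x÷ℕn]≡x n x ⟨
    ι n * (x ÷ℕ n)         ≡⟨ cong (ι n *_) eq ⟩
    ι n * (y ÷ℕ n)         ≡⟨ ιn*[x÷ℕn]≡x n y ⟩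
    y                      ∎
    where open ≡-Reasoning

  y≡x÷ℕn⇔ιn*y≡x : ∀ n .{{_ : NonZero n}} {x y} → (y ≡ x ÷ℕ n) ⇔ (ι n * y ≡ x)
  y≡x÷ℕn⇔ιn*y≡x n {x} {y} = mk⇔
    (λ y≡x÷n → trans (cong (ι n *_) y≡x÷n) (ιn*[x÷ℕn]≡x n x))
    (λ ny≡x → trans (sym ([ιn*x]÷ℕn≡x n y)) (cong (_÷ℕ n) ny≡x))

  m*n≡o*p⇒m/p≡o/n : ∀ m n o p .{{_ : NonZero n}} .{{_ : NonZero p}} →
                    m ℕ.* n ≡ o ℕ.* p → m ℕ./ p ≡ o ℕ./ n
  m*n≡o*p⇒m/p≡o/n m n o p eq = begin
    m ℕ./ p                   ≡⟨ ℕD.m*n/o*n≡m/o m n p ⟨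
    (m ℕ.* n) ℕ./ (p ℕ.* n)   ≡⟨ cong (ℕ._/ (p ℕ.* n)) (trans eq (ℕP.*-comm o p)) ⟩
    (p ℕ.* o) ℕ./ (p ℕ.* n)   ≡⟨ ℕD.m*n/m*o≡n/o p o n ⟩
    o ℕ./ n                   ∎
    where
    open ≡-Reasoning
    instance
      p*n≢0 : NonZero (p ℕ.* n)
      p*n≢0 = ℕP.m*n≢0 p n

  floor-ι-÷ℕ : ∀ m n .{{_ : NonZero n}} → floor (ι m ÷ℕ n) ≡ + (m ℕ./ n)
  floor-ι-÷ℕ m n@(suc d) = floor-of-≃ (ι m ÷ℕ n) (toℚᵘ-ι-÷ℕ m n)
    where
    floor-of-≃ : ∀ q → toℚᵘ q ≃ᵘ mkℚᵘ (+ m) d → floor q ≡ + (m ℕ./ n)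
    floor-of-≃ (mkℚ (+ a) e _) (*≡* eq) = trans (ℤP.*-identityˡ _) (cong +_
      (m*n≡o*p⇒m/p≡o/n a n m (suc e)
        (ℤP.+-injective (trans (ℤP.pos-* a n) (trans eq (sym (ℤP.pos-* m (suc e))))))))
    floor-of-≃ (mkℚ -[1+ a ] e _) (*≡* eq) with trans eq (sym (ℤP.pos-* m (suc e)))
    ... | ()

  ρ-ι-÷ℕ : ∀ m n .{{_ : NonZero n}} → ρ (ι m ÷ℕ n) ≡ ι m ÷ℕ n - ι (m ℕ./ n)
  ρ-ι-÷ℕ m n = cong (λ z → ι m ÷ℕ n - z / 1) (floor-ι-÷ℕ m n)

  ρ-ι-÷ℕ-self : ∀ n .{{_ : NonZero n}} → ρ (ι n ÷ℕ n) ≡ 0ℚ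
  ρ-ι-÷ℕ-self n = cong ρ (ιn÷ℕn≡1 n)

  ρ-ι-÷ℕ-< : ∀ {m n} .{{_ : NonZero n}} → m < n → ρ (ι m ÷ℕ n) ≡ ι m ÷ℕ n
  ρ-ι-÷ℕ-< {m} {n} m<n = begin
    ρ (ι m ÷ℕ n)                 ≡⟨ ρ-ι-÷ℕ m n ⟩
    ι m ÷ℕ n - ι (m ℕ./ n)       ≡⟨ cong (λ q → ι m ÷ℕ n - ι q) (ℕD.m<n⇒m/n≡0 m<n) ⟩
    ι m ÷ℕ n - 0ℚ                ≡⟨ +-identityʳ (ι m ÷ℕ n) ⟩
    ι m ÷ℕ n                     ∎
    where open ≡-Reasoning

  ρ-ι-÷ℕ-<2* : ∀ {m n} .{{_ : NonZero n}} → n ≤ m → m < 2 ℕ.* n →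
               ρ (ι m ÷ℕ n) ≡ ι m ÷ℕ n - 1ℚ
  ρ-ι-÷ℕ-<2* {m} {n} n≤m m<2n = trans (ρ-ι-÷ℕ m n) (cong (λ q → ι m ÷ℕ n - ι q) m/n≡1)
    where
    m/n≡1 : m ℕ./ n ≡ 1
    m/n≡1 = ℕP.≤-antisym (ℕP.<⇒≤pred (ℕD.m<n*o⇒m/o<n m<2n)) (ℕD.m≥n⇒m/n>0 n≤m)

  divℕ≡/ : ∀ m n .{{_ : NonZero n}} → m divℕ n ≡ m ℕ./ n
  divℕ≡/ m (suc _) = refl

  p-q≡r-s⇒p≡q⇔r≡s : ∀ {p q r s} → p - q ≡ r - s → (p ≡ q) ⇔ (r ≡ s)
  p-q≡r-s⇒p≡q⇔r≡s {p} {q} {r} {s} eq = mk⇔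
    (λ p≡q → x∙y⁻¹≈ε⇒x≈y +-0-group r s (trans (sym eq) (x≈y⇒x∙y⁻¹≈ε +-0-group p≡q)))
    (λ r≡s → x∙y⁻¹≈ε⇒x≈y +-0-group p q (trans eq (x≈y⇒x∙y⁻¹≈ε +-0-group r≡s)))

  Σℚ-cong : ∀ i {f g : ℕ → ℚ} → (∀ j → f (suc j) ≡ g (suc j)) → Σℚ i f ≡ Σℚ i g
  Σℚ-cong zero    eq = refl
  Σℚ-cong (suc i) eq = cong₂ _+_ (Σℚ-cong i eq) (eq i)

  Σℚ-*-− : ∀ i a f g → Σℚ i (λ j → a * f j - g j) ≡ a * Σℚ i f - Σℚ i g
  Σℚ-*-− zero    a f g = solve 1 (λ a → con 0ℚ := a :* con 0ℚ :- con 0ℚ) refl a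
  Σℚ-*-− (suc i) a f g = begin
    Σℚ i (λ j → a * f j - g j) + (a * f (suc i) - g (suc i))
      ≡⟨ cong (_+ (a * f (suc i) - g (suc i))) (Σℚ-*-− i a f g) ⟩
    (a * Σℚ i f - Σℚ i g) + (a * f (suc i) - g (suc i))
      ≡⟨ solve 5 (λ a F G x y → (a :* F :- G) :+ (a :* x :- y) := a :* (F :+ x) :- (G :+ y))
           refl a (Σℚ i f) (Σℚ i g) (f (suc i)) (g (suc i)) ⟩
    a * (Σℚ i f + f (suc i)) - (Σℚ i g + g (suc i)) ∎
    where open ≡-Reasoning

  Σℤ-/1 : ∀ i g → Σℤ i g / 1 ≡ Σℚ i (λ j → g j / 1)
  Σℤ-/1 zero    g = refl
  Σℤ-/1 (suc i) g = trans (/1-homo-+ (Σℤ i g) (g (suc i))) (cong (_+ g (suc i) / 1) (Σℤ-/1 i g))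

  ∀≤⇒∀+ : ∀ {P : ℕ → Set} m → (∀ i → m ≤ i → P i) → ∀ n → P (m ℕ.+ n)
  ∀≤⇒∀+ m h n = h (m ℕ.+ n) (ℕP.m≤m+n m n)

  ∀+⇒∀≤ : ∀ {P : ℕ → Set} m → (∀ n → P (m ℕ.+ n)) → ∀ i → m ≤ i → P i
  ∀+⇒∀≤ {P} m h i m≤i = subst P (ℕP.m+[n∸m]≡n m≤i) (h (i ∸ m))

module Conditions (k : ℕ → ℕ) (k₁≡1 : k 1 ≡ 1) (k₂≡2 : k 2 ≡ 2)
                  (k-increasing : ∀ i → 2 ≤ i → k i < k (suc i)) where
  open import Data.Nat as ℕ using (_∸_; z≤n; NonZero)
  import Data.Nat.Properties as ℕP
  import Data.Nat.DivMod as ℕD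
  open import Data.Integer as ℤ using (+_)
  import Data.Integer.Properties as ℤP
  open import Data.Rational as ℚ using (ℚ; 0ℚ; 1ℚ; _+_; _-_; _*_; _/_)
  open import Data.Rational.Properties using (*-identityʳ)
  open import Data.Rational.Solver using (module +-*-Solver)
  open import Function.Bundles using (Equivalence)

  open Arithmetic
  open +-*-Solver
  open Equivalence using (to; from)

  k>0 : ∀ i → 0 < k (suc i)
  k>0 zero          = subst (0 <_) (sym k₁≡1) ℕ.z<s
  k>0 (suc zero)    = subst (0 <_) (sym k₂≡2) ℕ.z<s
  k>0 (suc (suc i)) = ℕP.≤-<-trans z≤n (k-increasing (2 ℕ.+ i) (ℕP.m≤m+n 2 i))

  instance
    k-nonZero : ∀ {i} → NonZero (k (suc i))
    k-nonZero {i} = ℕ.>-nonZero (k>0 i)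

  K : ℕ → ℚ
  K i = ι (k i)

  β : ℕ → ℚ
  β i = b k i (K i)

  T : ℕ → ℚ
  T i = (1ℚ + β i) ÷ℕ k i

  Σρ-below : ℕ → ℚ → ℚ
  Σρ-below i x = Σℚ (i ∸ 1) (λ j → μq (k j) * ρ (x ÷ℕ k j))

  Σ⌊⌋-below : ℕ → ℚ
  Σ⌊⌋-below i = Σℚ (i ∸ 1) (λ j → μq (k j) * ι (k i divℕ k j))

  A A′ : ℕ → Set
  A i  = S k i ≡ T i
  A′ i = K i * S k i ≡ 1ℚ + β i

  B : ℕ → ℚ → Set
  B i x = b k i x ≡ Σρ-below i x - (K i * S k (i ∸ 1)) * ρ (x ÷ℕ k i)

  C D E : ℕ → Set
  C i = μq (k i) ÷ℕ k i ≡ T i - T (i ∸ 1)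
  D i = μq (k (suc i)) ≡ b k i (K (suc i)) - β i
  E i = Σℤ i (λ j → μ (k j) ℤ.* + (k i divℕ k j)) ≡ + 1

  A⇔A′ : ∀ i → A (suc i) ⇔ A′ (suc i)
  A⇔A′ i = y≡x÷ℕn⇔ιn*y≡x (k (suc i))

  A₂ : A 2
  A₂ rewrite k₁≡1 | k₂≡2 = refl

  B₂ : ∀ x → B 2 x
  -- Once k₁ = 1, x ÷ℕ k₁ is x * 1ℚ and S k 1 computes to 0ℚ + 1ℚ * 1ℚ.
  B₂ x rewrite k₁≡1 =
    solve 3 (λ r K r′ → r :- (K :* con 1ℚ) :* r′
                        := (con 0ℚ :+ con 1ℚ :* r) :- (K :* (con 0ℚ :+ con 1ℚ :* con 1ℚ)) :* r′)
      refl (ρ (x * 1ℚ)) (K 2) (ρ (x ÷ℕ k 2))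

  E₁ : E 1
  E₁ rewrite k₁≡1 = refl

  B-suc : ∀ n x → A′ (2 ℕ.+ n) → B (2 ℕ.+ n) x → B (3 ℕ.+ n) x
  B-suc n x Aᵢ Bᵢ = begin
    b k i x + (1ℚ + β i) * (r₁ - q * r₂)
      ≡⟨ cong₂ (λ u v → u + v * (r₁ - q * r₂)) Bᵢ (sym Aᵢ) ⟩
    (P - (K i * s) * r₁) + (K i * (s + m)) * (r₁ - q * r₂)
      ≡⟨ solve 7 (λ P K s m q r₁ r₂ → (P :- (K :* s) :* r₁) :+ (K :* (s :+ m)) :* (r₁ :- q :* r₂)
                                     := (P :+ (K :* m) :* r₁) :- ((K :* q) :* (s :+ m)) :* r₂)
           refl P (K i) s m q r₁ r₂ ⟩
    (P + (K i * m) * r₁) - ((K i * q) * (s + m)) * r₂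
      ≡⟨ cong₂ (λ u v → (P + u * r₁) - (v * (s + m)) * r₂)
           (ιn*[x÷ℕn]≡x (k i) (μq (k i))) (ιn*[x÷ℕn]≡x (k i) (K (suc i))) ⟩
    (P + μq (k i) * r₁) - (K (suc i) * (s + m)) * r₂ ∎
    where
    open ≡-Reasoning
    i  = 2 ℕ.+ n
    s  = S k (suc n)
    m  = μq (k i) ÷ℕ k i
    q  = K (suc i) ÷ℕ k i
    r₁ = ρ (x ÷ℕ k i)
    r₂ = ρ (x ÷ℕ k (suc i))
    P  = Σρ-below i x

  B-everywhere : (∀ n → (∀ x → B (2 ℕ.+ n) x) → A (2 ℕ.+ n)) → ∀ n x → B (2 ℕ.+ n) x
  B-everywhere Aₙ-from-Bₙ zero    x = B₂ x
  B-everywhere Aₙ-from-Bₙ (suc n) x = B-suc n x (to (A⇔A′ (suc n)) (Aₙ-from-Bₙ n Bₙ)) (Bₙ x)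
    where Bₙ = B-everywhere Aₙ-from-Bₙ n

  B-from-A : CondA k → ∀ n x → B (2 ℕ.+ n) x
  B-from-A As = B-everywhere (λ n _ → ∀≤⇒∀+ 2 As n)

  β≡Σρ-below : ∀ n → B (2 ℕ.+ n) (K (2 ℕ.+ n)) →
               β (2 ℕ.+ n) ≡ Σρ-below (2 ℕ.+ n) (K (2 ℕ.+ n))
  β≡Σρ-below n Bᵢ = begin
    β i                            ≡⟨ Bᵢ ⟩
    P - (K i * s) * ρ (K i ÷ℕ k i) ≡⟨ cong (λ r → P - (K i * s) * r) (ρ-ι-÷ℕ-self (k i)) ⟩
    P - (K i * s) * 0ℚ             ≡⟨ solve 2 (λ P Ks → P :- Ks :* con 0ℚ := P) refl P (K i * s) ⟩
    P                              ∎
    where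
    open ≡-Reasoning
    i = 2 ℕ.+ n
    s = S k (suc n)
    P = Σρ-below i (K i)

  A-from-B : ∀ n → B (2 ℕ.+ n) (K (2 ℕ.+ n)) → B (3 ℕ.+ n) (K (2 ℕ.+ n)) → A (2 ℕ.+ n)
  A-from-B n Bᵢ Bᵢ₊₁ = from (A⇔A′ (suc n)) (begin
    K i * S k i
      ≡⟨ cong (_* S k i) (ιn*[x÷ℕn]≡x (k (suc i)) (K i)) ⟨
    (K (suc i) * u) * S k i
      ≡⟨ solve 4 (λ K′ u S P → (K′ :* u) :* S := P :- (P :- (K′ :* S) :* u))
           refl (K (suc i)) u (S k i) P ⟩
    P - (P - (K (suc i) * S k i) * u)
      ≡⟨ cong (P -_) (trans (sym via-B) via-recursion) ⟩
    P - (P + c * (0ℚ - q * u))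
      ≡⟨ solve 4 (λ P c q u → P :- (P :+ c :* (con 0ℚ :- q :* u)) := c :* (q :* u)) refl P c q u ⟩
    c * (q * u)
      ≡⟨ cong (c *_) ([ιm÷ℕn]*[ιn÷ℕm]≡1 (k (suc i)) (k i)) ⟩
    c * 1ℚ
      ≡⟨ *-identityʳ c ⟩
    c ∎)
    where
    open ≡-Reasoning
    i = 2 ℕ.+ n
    c = 1ℚ + β i
    P = Σρ-below i (K i)
    q = K (suc i) ÷ℕ k i
    u = K i ÷ℕ k (suc i)
    ρ-self : ρ (K i ÷ℕ k i) ≡ 0ℚ
    ρ-self = ρ-ι-÷ℕ-self (k i)
    ρ-small : ρ (K i ÷ℕ k (suc i)) ≡ u
    ρ-small = ρ-ι-÷ℕ-< (k-increasing i (ℕP.m≤m+n 2 n))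
    via-recursion : b k (suc i) (K i) ≡ P + c * (0ℚ - q * u)
    via-recursion = begin
      β i + c * (ρ (K i ÷ℕ k i) - q * ρ (K i ÷ℕ k (suc i)))
        ≡⟨ cong (λ t → t + c * (ρ (K i ÷ℕ k i) - q * ρ (K i ÷ℕ k (suc i)))) (β≡Σρ-below n Bᵢ) ⟩
      P + c * (ρ (K i ÷ℕ k i) - q * ρ (K i ÷ℕ k (suc i)))
        ≡⟨ cong₂ (λ y z → P + c * (y - q * z)) ρ-self ρ-small ⟩
      P + c * (0ℚ - q * u) ∎
    via-B : b k (suc i) (K i) ≡ P - (K (suc i) * S k i) * u
    via-B = begin
      b k (suc i) (K i)
        ≡⟨ Bᵢ₊₁ ⟩
      (P + μq (k i) * ρ (K i ÷ℕ k i)) - (K (suc i) * S k i) * ρ (K i ÷ℕ k (suc i))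
        ≡⟨ cong₂ (λ y z → (P + μq (k i) * y) - (K (suc i) * S k i) * z) ρ-self ρ-small ⟩
      (P + μq (k i) * 0ℚ) - (K (suc i) * S k i) * u
        ≡⟨ solve 4 (λ P μ KS u → (P :+ μ :* con 0ℚ) :- KS :* u := P :- KS :* u)
             refl P (μq (k i)) (K (suc i) * S k i) u ⟩
      P - (K (suc i) * S k i) * u ∎

  C-from-A : ∀ n → A (3 ℕ.+ n) → A (2 ℕ.+ n) → C (3 ℕ.+ n)
  C-from-A n Aᵢ₊₁ Aᵢ = trans (solve 2 (λ s m → m := (s :+ m) :- s) refl (S k (2 ℕ.+ n)) m)
                             (cong₂ _-_ Aᵢ₊₁ Aᵢ)
    where m = μq (k (3 ℕ.+ n)) ÷ℕ k (3 ℕ.+ n)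

  A-from-C : (∀ n → C (3 ℕ.+ n)) → ∀ n → A (2 ℕ.+ n)
  A-from-C Cs zero    = A₂
  A-from-C Cs (suc n) = trans (cong₂ _+_ (A-from-C Cs n) (Cs n))
                              (solve 2 (λ t t′ → t :+ (t′ :- t) := t′) refl (T (2 ℕ.+ n)) (T (3 ℕ.+ n)))

  Cᵢ₊₁⇔Dᵢ : ∀ n → k (3 ℕ.+ n) < 2 ℕ.* k (2 ℕ.+ n) → C (3 ℕ.+ n) ⇔ D (2 ℕ.+ n)
  Cᵢ₊₁⇔Dᵢ n bound = mk⇔ (λ Cᵢ₊₁ → ÷ℕ-injective (k (suc i)) (trans Cᵢ₊₁ increment))
                        (λ Dᵢ → trans (cong (_÷ℕ k (suc i)) Dᵢ) (sym increment))
    where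
    i = 2 ℕ.+ n
    c = 1ℚ + β i
    q = K (suc i) ÷ℕ k i
    x = b k i (K (suc i))
    increment : T (suc i) - T i ≡ (x - β i) ÷ℕ k (suc i)
    increment = from (y≡x÷ℕn⇔ιn*y≡x (k (suc i))) (begin
      K (suc i) * (T (suc i) - T i)
        ≡⟨ solve 3 (λ K′ t′ t → K′ :* (t′ :- t) := K′ :* t′ :- K′ :* t)
             refl (K (suc i)) (T (suc i)) (T i) ⟩
      K (suc i) * T (suc i) - K (suc i) * T i
        ≡⟨ cong₂ _-_ (ιn*[x÷ℕn]≡x (k (suc i)) (1ℚ + β (suc i))) (*-÷ℕ-comm (K (suc i)) c (k i)) ⟩
      (1ℚ + (x + c * (ρ q - q * ρ (K (suc i) ÷ℕ k (suc i))))) - c * q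
        ≡⟨ cong₂ (λ y z → (1ℚ + (x + c * (y - q * z))) - c * q)
             (ρ-ι-÷ℕ-<2* (ℕP.<⇒≤ (k-increasing i (ℕP.m≤m+n 2 n))) bound) (ρ-ι-÷ℕ-self (k (suc i))) ⟩
      (1ℚ + (x + c * ((q - 1ℚ) - q * 0ℚ))) - c * q
        ≡⟨ solve 3 (λ x β q → (con 1ℚ :+ (x :+ (con 1ℚ :+ β) :* ((q :- con 1ℚ) :- q :* con 0ℚ)))
                                :- (con 1ℚ :+ β) :* q := x :- β)
             refl x (β i) q ⟩
      x - β i ∎)
      where open ≡-Reasoning

  Σρ-below≡ : ∀ n → Σρ-below (2 ℕ.+ n) (K (2 ℕ.+ n))
                   ≡ K (2 ℕ.+ n) * S k (suc n) - Σ⌊⌋-below (2 ℕ.+ n)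
  Σρ-below≡ n = trans (Σℚ-cong (suc n) termwise) (Σℚ-*-− (suc n) (K i) _ _)
    where
    i = 2 ℕ.+ n
    termwise : ∀ j → μq (k (suc j)) * ρ (K i ÷ℕ k (suc j))
                     ≡ K i * (μq (k (suc j)) ÷ℕ k (suc j)) - μq (k (suc j)) * ι (k i divℕ k (suc j))
    termwise j = begin
      μⱼ * ρ (K i ÷ℕ kⱼ)                          ≡⟨ cong (μⱼ *_) (ρ-ι-÷ℕ (k i) kⱼ) ⟩
      μⱼ * (K i ÷ℕ kⱼ - ι (k i ℕ./ kⱼ))           ≡⟨ solve 3 (λ μ a d → μ :* (a :- d) := μ :* a :- μ :* d)
                                                       refl μⱼ (K i ÷ℕ kⱼ) (ι (k i ℕ./ kⱼ)) ⟩
      μⱼ * (K i ÷ℕ kⱼ) - μⱼ * ι (k i ℕ./ kⱼ)      ≡⟨ cong₂ (λ y z → y - μⱼ * ι z)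
                                                       (*-÷ℕ-comm μⱼ (K i) kⱼ) (sym (divℕ≡/ (k i) kⱼ)) ⟩
      K i * (μⱼ ÷ℕ kⱼ) - μⱼ * ι (k i divℕ kⱼ)     ∎
      where
      open ≡-Reasoning
      kⱼ = k (suc j)
      μⱼ = μq kⱼ

  Σ⌊⌋-below+μ≡1⇔E : ∀ n → (Σ⌊⌋-below (2 ℕ.+ n) + μq (k (2 ℕ.+ n)) ≡ 1ℚ) ⇔ E (2 ℕ.+ n)
  Σ⌊⌋-below+μ≡1⇔E n = mk⇔ (λ eq → /1-injective (trans E-sum eq))
                          (λ Eᵢ → trans (sym E-sum) (cong (_/ 1) Eᵢ))
    where
    i = 2 ℕ.+ n
    last-term : (μ (k i) ℤ.* + (k i divℕ k i)) / 1 ≡ μq (k i)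
    last-term = cong (_/ 1) (begin
      μ (k i) ℤ.* + (k i divℕ k i)   ≡⟨ cong (λ d → μ (k i) ℤ.* + d) (divℕ≡/ (k i) (k i)) ⟩
      μ (k i) ℤ.* + (k i ℕ./ k i)    ≡⟨ cong (λ d → μ (k i) ℤ.* + d) (ℕD.n/n≡1 (k i)) ⟩
      μ (k i) ℤ.* + 1                ≡⟨ ℤP.*-identityʳ (μ (k i)) ⟩
      μ (k i)                        ∎)
      where open ≡-Reasoning
    E-sum : Σℤ i (λ j → μ (k j) ℤ.* + (k i divℕ k j)) / 1 ≡ Σ⌊⌋-below i + μq (k i)
    E-sum = trans (Σℤ-/1 i _) (cong₂ _+_
      (Σℚ-cong (suc n) (λ j → /1-homo-* (μ (k (suc j))) (+ (k i divℕ k (suc j)))))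
      last-term)

  Aᵢ⇔Eᵢ : ∀ n → B (2 ℕ.+ n) (K (2 ℕ.+ n)) → A (2 ℕ.+ n) ⇔ E (2 ℕ.+ n)
  Aᵢ⇔Eᵢ n Bᵢ =
    ⇔-trans (A⇔A′ (suc n)) (⇔-trans (p-q≡r-s⇒p≡q⇔r≡s difference) (Σ⌊⌋-below+μ≡1⇔E n))
    where
    open ≡-Reasoning
    i = 2 ℕ.+ n
    s = S k (suc n)
    m = μq (k i) ÷ℕ k i
    Z = Σ⌊⌋-below i
    difference : K i * S k i - (1ℚ + β i) ≡ (Z + μq (k i)) - 1ℚ
    difference = begin
      K i * (s + m) - (1ℚ + β i)
        ≡⟨ cong (λ t → K i * (s + m) - (1ℚ + t)) (trans (β≡Σρ-below n Bᵢ) (Σρ-below≡ n)) ⟩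
      K i * (s + m) - (1ℚ + (K i * s - Z))
        ≡⟨ solve 4 (λ K s m Z → K :* (s :+ m) :- (con 1ℚ :+ (K :* s :- Z))
                                 := (Z :+ K :* m) :- con 1ℚ)
             refl (K i) s m Z ⟩
      (Z + K i * m) - 1ℚ
        ≡⟨ cong (λ t → (Z + t) - 1ℚ) (ιn*[x÷ℕn]≡x (k i) (μq (k i))) ⟩
      (Z + μq (k i)) - 1ℚ ∎

  A⇔B : CondA k ⇔ CondB k
  A⇔B = mk⇔
    (λ As → ∀+⇒∀≤ 2 (λ n x _ → B-from-A As n x))
    (λ Bs → ∀+⇒∀≤ 2 (λ n → A-from-B n (at-kᵢ Bs n) (at-kᵢ Bs (suc n))))
    where
    at-kᵢ : CondB k → ∀ m {n} → B (2 ℕ.+ m) (K (2 ℕ.+ n))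
    at-kᵢ Bs m {n} = ∀≤⇒∀+ 2 Bs m (K (2 ℕ.+ n)) (0≤ι (k (2 ℕ.+ n)))

  A⇔C : CondA k ⇔ CondC k
  A⇔C = mk⇔
    (λ As → ∀+⇒∀≤ 3 (λ n → C-from-A n (∀≤⇒∀+ 2 As (suc n)) (∀≤⇒∀+ 2 As n)))
    (λ Cs → ∀+⇒∀≤ 2 (A-from-C (∀≤⇒∀+ 3 Cs)))

  C⇔D : (∀ i → 2 ≤ i → k (suc i) < 2 ℕ.* k i) → CondC k ⇔ CondD k
  C⇔D bound = mk⇔
    (λ Cs → ∀+⇒∀≤ 2 (λ n → to (Cᵢ₊₁⇔Dᵢ n (∀≤⇒∀+ 2 bound n)) (∀≤⇒∀+ 3 Cs n)))
    (λ Ds → ∀+⇒∀≤ 3 (λ n → from (Cᵢ₊₁⇔Dᵢ n (∀≤⇒∀+ 2 bound n)) (∀≤⇒∀+ 2 Ds n)))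

  A⇔E : CondA k ⇔ CondE k
  A⇔E = mk⇔
    (λ As → ∀+⇒∀≤ 1 λ
      { zero    → E₁
      ; (suc n) → to (Aᵢ⇔Eᵢ n (B-from-A As n (K (2 ℕ.+ n)))) (∀≤⇒∀+ 2 As n) })
    (λ Es → ∀+⇒∀≤ 2 (λ n → from (Aᵢ⇔Eᵢ n (B-from-E Es n (K (2 ℕ.+ n)))) (∀≤⇒∀+ 1 Es (suc n))))
    where
    B-from-E : CondE k → ∀ n x → B (2 ℕ.+ n) x
    B-from-E Es = B-everywhere (λ n Bₙ → from (Aᵢ⇔Eᵢ n (Bₙ (K (2 ℕ.+ n)))) (∀≤⇒∀+ 1 Es (suc n)))

open import Data.Nat using (_*_)

lemma5 : (k : ℕ → ℕ) → IsKSeq k →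
    (CondA k ⇔ CondB k) × (CondA k ⇔ CondC k) ×
    ((∀ i → 2 ≤ i → k (suc i) < 2 * k i) →
       (CondA k ⇔ CondD k) × (CondA k ⇔ CondE k))
lemma5 k (k₁≡1 , k₂≡2 , step) = A⇔B , A⇔C , λ bound → ⇔-trans A⇔C (C⇔D bound) , A⇔E
  where open Conditions k k₁≡1 k₂≡2 (λ i 2≤i → proj₁ (step i 2≤i))
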